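{- For $i, j\in \mathbb F_q^*,$ let $E$ and $F$ be subsets of $D_i$ and $D_j$, respectively. Suppose that for all $\ell\in \mathbb F_q,$ the following two inequalities hold: $$ |R_\ell(E,F)|^2 \le 2q^2|E||F|+ 7|E||F|^2+ 2q|E| M(F,F)$$ and $$ |R_\ell(F,F)|^2 \le 2q^2|F|^2+ 7|F|^3+ 2q|F| M(F,F).$$ Then, for every $t\in \mathbb F_q$, we have $$ \left|N_t(E,F)-\frac{|E||F|}{q}\right|\le \sqrt{18q^2|E||F| + 11|E||F|^2+ 4\sqrt{7}q|E||F|^{\frac{3}{2}}}.$$
   Context: $\mathbb F_q$ is a finite field with $q$ elements, $q$ an odd prime power, and $M_2(\mathbb F_q)$ is the set of $2\times 2$ matrices over $\mathbb F_q$; $D_i=\{x\in M_2(\mathbb F_q):\det(x)=i\}$. For $x=\left(\begin{matrix} x_1&x_2\\ x_3&x_4\end{matrix}\right), y=\left(\begin{matrix} y_1&y_2\\ y_3&y_4\end{matrix}\right)$, the Odot-product is $x\odot y= x_1y_4-x_2y_3-x_3y_2+x_4y_1$. For sets $E,F\subseteq M_2(\mathbb F_q)$: $N_t(E,F)$ is the number of pairs $(x,y)\in E\times F$ with $\det(x+y)=t$; $W_\ell(E,F)$ is the number of pairs $(x,y)\in E\times F$ with $x\odot y=\ell$; $R_\ell(E,F)=W_\ell(E,F)-|E||F|/q$; and $M(E,F)=\max_{\ell\in\mathbb F_q}W_\ell(E,F)$. -}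

module Defs where

open import Level using (Level; 0ℓ)
open import Data.Bool using (Bool; true; false; if_then_else_)
open import Data.Nat as ℕ using (ℕ; zero; suc; _%_)
open import Data.Integer as ℤ using (ℤ; +_)
open import Data.Rational as ℚ using (ℚ; _≤_; _+_; _-_; _*_; ∣_∣; 0ℚ; _/_)
open import Data.List using (List; []; _∷_; length; map; concatMap; foldr)
open import Data.Nat.ListAction using (sum)
open import Data.List.Membership.Propositional using (_∈_)
open import Data.List.Relation.Unary.Unique.Propositional using (Unique)
open import Data.Product using (Σ; _×_; _,_)
open import Data.Sum using (_⊎_)
open import Relation.Nullary using (¬_; does)
open import Relation.Binary.PropositionalEquality using (_≡_)
open import Relation.Binary.Definitions using (DecidableEquality)
open import Algebra.Structures using (IsCommutativeRing)

record FiniteField : Set₁ where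
  field
    Carrier  : Set
    _⊕_ _⊗_  : Carrier → Carrier → Carrier
    ⊝_       : Carrier → Carrier
    0# 1#    : Carrier
    isCommutativeRing : IsCommutativeRing _≡_ _⊕_ _⊗_ ⊝_ 0# 1#
    0≢1      : ¬ (0# ≡ 1#)
    inverse  : ∀ x → ¬ (x ≡ 0#) → Σ Carrier λ y → x ⊗ y ≡ 1#
    _≟_      : DecidableEquality Carrier
    elems    : List Carrier
    complete : ∀ x → x ∈ elems
    unique   : Unique elems

  q : ℕ
  q = length elems

  _⊖_ : Carrier → Carrier → Carrier
  x ⊖ y = x ⊕ (⊝ y)

  -- 2×2 matrices (x₁ x₂ ; x₃ x₄)
  record Mat : Set where
    constructor mat
    field
      m₁ m₂ m₃ m₄ : Carrier
  open Mat public

  det : Mat → Carrier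
  det x = (m₁ x ⊗ m₄ x) ⊖ (m₂ x ⊗ m₃ x)

  _+M_ : Mat → Mat → Mat
  x +M y = mat (m₁ x ⊕ m₁ y) (m₂ x ⊕ m₂ y) (m₃ x ⊕ m₃ y) (m₄ x ⊕ m₄ y)

  _⊙_ : Mat → Mat → Carrier
  x ⊙ y = (((m₁ x ⊗ m₄ y) ⊖ (m₂ x ⊗ m₃ y)) ⊖ (m₃ x ⊗ m₂ y)) ⊕ (m₄ x ⊗ m₁ y)

  allMats : List Mat
  allMats = concatMap (λ a → concatMap (λ b → concatMap (λ c → map (λ d → mat a b c d)
              elems) elems) elems) elems

  Subset : Set
  Subset = Mat → Bool

  _⊆D_ : Subset → Carrier → Set
  E ⊆D i = ∀ x → E x ≡ true → det x ≡ i

  ind : Bool → ℕ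
  ind true = 1
  ind false = 0

  card : Subset → ℕ
  card E = sum (map (λ x → ind (E x)) allMats)

  countPairs : Subset → Subset → (Mat → Mat → Bool) → ℕ
  countPairs E F P = sum (concatMap (λ x → map (λ y →
    if E x then (if F y then ind (P x y) else 0) else 0) allMats) allMats)

  N : Carrier → Subset → Subset → ℕ
  N t E F = countPairs E F (λ x y → does (det (x +M y) ≟ t))

  W : Carrier → Subset → Subset → ℕ
  W ℓ E F = countPairs E F (λ x y → does ((x ⊙ y) ≟ ℓ))

  M : Subset → Subset → ℕ
  M E F = foldr ℕ._⊔_ 0 (map (λ ℓ → W ℓ E F) elems)

  -- n / q as a rational number (q ≥ 1 always holds since 0# ∈ elems)
  _/q : ℕ → ℚ
  n /q with q
  ... | zero  = 0ℚ
  ... | suc k = (+ n) / suc k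

  ℕ→ℚ : ℕ → ℚ
  ℕ→ℚ n = (+ n) / 1

  R : Carrier → Subset → Subset → ℚ
  R ℓ E F = ℕ→ℚ (W ℓ E F) - ((card E ℕ.* card F) /q)

  sq : ℚ → ℚ
  sq r = r * r

-- a ≤ √(b + c·√d)  for a, b, c, d ≥ 0 rational, a ≥ 0, written without reals:
--   a² ≤ b + c√d  ⇔  (a² − b ≤ 0) or (a² − b)² ≤ c²·d.
LeSqrtPlusSqrt : ℚ → ℚ → ℚ → ℚ → Set
LeSqrtPlusSqrt a b c d = ((a * a) - b ≤ 0ℚ) ⊎ (((a * a) - b) * ((a * a) - b) ≤ (c * c) * d)

module Submission where

open import Defs
open import Data.Nat using (_%_)
open import Data.Rational using (_≤_; _+_; _*_; _-_; ∣_∣)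
open import Relation.Nullary using (¬_)
open import Relation.Binary.PropositionalEquality using (_≡_)

open import Level using (0ℓ)
open import Function using (_∘_; _$_; _⇔_; mk⇔)
open import Data.Bool using (Bool; true; false; if_then_else_)
open import Data.Maybe using (nothing)
open import Data.Nat as ℕ using (ℕ; suc; _⊔_)
import Data.Nat.Properties as ℕ
open import Data.Integer as ℤ using (+_)
import Data.Integer.Properties as ℤ
open import Data.List using ([]; _∷_; foldr; foldl; map; concat; length)
open import Data.List.Membership.Propositional using (_∈_)
open import Data.List.Properties using (map-cong)
open import Data.Nat.ListAction using (sum)
open import Data.Product using (∃-syntax; _,_; proj₁; proj₂)
open import Data.Sum using (_⊎_; inj₁; inj₂)
open import Data.Rational using (ℚ; 0ℚ; _/_; toℚᵘ; fromℚᵘ; nonNegative)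
open import Data.Rational.Properties hiding (_≟_)
open import Data.Rational.Unnormalised as ℚᵘ using (mkℚᵘ; *≡*)
import Data.Rational.Unnormalised.Properties as ℚᵘ
open import Relation.Nullary using (yes; no)
open import Relation.Nullary.Decidable using (does-⇔)
open import Relation.Binary.PropositionalEquality using (refl; sym; trans; cong; cong₂; subst; module ≡-Reasoning)
open import Algebra.Bundles using (CommutativeRing)
import Algebra.Properties.Group as GroupProperties
import Tactic.RingSolver.NonReflective
open import Tactic.RingSolver.Core.AlmostCommutativeRing using (fromCommutativeRing)
open import Data.Rational.Solver using (module +-*-Solver)
open +-*-Solver using (Polynomial; con; solve; _:=_; _:+_; _:*_; _:-_; :-_)

-- Since det (x + y) = det x + det y + x ⊙ y, on D_i × D_j the condition det (x + y) = t
-- reads x ⊙ y = t − i − j, so N_t(E,F) = W_{t−i−j}(E,F).  The maximum M(F,F) is attained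
-- at some W_ℓ(F,F); there the second hypothesis is a quadratic inequality in
-- r = M(F,F) − |F|²/q which, using q · (|F|²/q) = |F|², gives
-- M(F,F) − 8q|F| − 2|F|²/q ≤ 3|F|^{3/2}.  Substituted into the first hypothesis at
-- ℓ = t − i − j this bounds |N_t(E,F) − |E||F|/q|² by 18q²|E||F| + 11|E||F|² + 6q|E||F|^{3/2},
-- and 6 ≤ 4√7.

-- Defs' cast ℕ→ℚ, available outside the FiniteField record.
fromℕ : ℕ → ℚ
fromℕ n = + n / 1

fromℚᵘ-homo-+ : ∀ p r → fromℚᵘ (p ℚᵘ.+ r) ≡ fromℚᵘ p + fromℚᵘ r
fromℚᵘ-homo-+ p r = toℚᵘ-injective (begin
  toℚᵘ (fromℚᵘ (p ℚᵘ.+ r))               ≈⟨ toℚᵘ-fromℚᵘ (p ℚᵘ.+ r) ⟩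
  p ℚᵘ.+ r                               ≈⟨ ℚᵘ.+-cong (toℚᵘ-fromℚᵘ p) (toℚᵘ-fromℚᵘ r) ⟨
  toℚᵘ (fromℚᵘ p) ℚᵘ.+ toℚᵘ (fromℚᵘ r)  ≈⟨ toℚᵘ-homo-+ (fromℚᵘ p) (fromℚᵘ r) ⟨
  toℚᵘ (fromℚᵘ p + fromℚᵘ r)            ∎)
  where open ℚᵘ.≃-Reasoning

fromℚᵘ-homo-* : ∀ p r → fromℚᵘ (p ℚᵘ.* r) ≡ fromℚᵘ p * fromℚᵘ r
fromℚᵘ-homo-* p r = toℚᵘ-injective (begin
  toℚᵘ (fromℚᵘ (p ℚᵘ.* r))               ≈⟨ toℚᵘ-fromℚᵘ (p ℚᵘ.* r) ⟩
  p ℚᵘ.* r                               ≈⟨ ℚᵘ.*-cong (toℚᵘ-fromℚᵘ p) (toℚᵘ-fromℚᵘ r) ⟨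
  toℚᵘ (fromℚᵘ p) ℚᵘ.* toℚᵘ (fromℚᵘ r)  ≈⟨ toℚᵘ-homo-* (fromℚᵘ p) (fromℚᵘ r) ⟨
  toℚᵘ (fromℚᵘ p * fromℚᵘ r)            ∎)
  where open ℚᵘ.≃-Reasoning

fromℕ-homo-+ : ∀ m n → fromℕ (m ℕ.+ n) ≡ fromℕ m + fromℕ n
fromℕ-homo-+ m n = trans (fromℚᵘ-cong sum-≃) (fromℚᵘ-homo-+ (mkℚᵘ (+ m) 0) (mkℚᵘ (+ n) 0))
  where
  open ≡-Reasoning
  sum-≃ : mkℚᵘ (+ (m ℕ.+ n)) 0 ℚᵘ.≃ mkℚᵘ (+ m) 0 ℚᵘ.+ mkℚᵘ (+ n) 0
  sum-≃ = *≡* (begin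
    + (m ℕ.+ n) ℤ.* + 1                    ≡⟨ ℤ.*-identityʳ _ ⟩
    + (m ℕ.+ n)                            ≡⟨ ℤ.pos-+ m n ⟩
    + m ℤ.+ + n                            ≡⟨ cong₂ ℤ._+_ (ℤ.*-identityʳ (+ m)) (ℤ.*-identityʳ (+ n)) ⟨
    + m ℤ.* + 1 ℤ.+ + n ℤ.* + 1           ≡⟨ ℤ.*-identityʳ _ ⟨
    (+ m ℤ.* + 1 ℤ.+ + n ℤ.* + 1) ℤ.* + 1 ∎)

fromℕ-homo-* : ∀ m n → fromℕ (m ℕ.* n) ≡ fromℕ m * fromℕ n
fromℕ-homo-* m n = trans (fromℚᵘ-cong prod-≃) (fromℚᵘ-homo-* (mkℚᵘ (+ m) 0) (mkℚᵘ (+ n) 0))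
  where
  prod-≃ : mkℚᵘ (+ (m ℕ.* n)) 0 ℚᵘ.≃ mkℚᵘ (+ m) 0 ℚᵘ.* mkℚᵘ (+ n) 0
  prod-≃ = *≡* (cong (ℤ._* + 1) (ℤ.pos-* m n))

fromℕ-foldl-* : ∀ k xs → fromℕ (foldl ℕ._*_ k xs) ≡ foldl _*_ (fromℕ k) (map fromℕ xs)
fromℕ-foldl-* k []       = refl
fromℕ-foldl-* k (x ∷ xs) =
  trans (fromℕ-foldl-* (k ℕ.* x) xs) (cong (λ z → foldl _*_ z (map fromℕ xs)) (fromℕ-homo-* k x))

fromℕ-*-/ : ∀ n k → fromℕ (suc k) * (+ n / suc k) ≡ fromℕ n
fromℕ-*-/ n k = trans (sym (fromℚᵘ-homo-* (mkℚᵘ (+ suc k) 0) (mkℚᵘ (+ n) k))) (fromℚᵘ-cong cancel-≃)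
  where
  open ≡-Reasoning
  cancel-≃ : mkℚᵘ (+ suc k) 0 ℚᵘ.* mkℚᵘ (+ n) k ℚᵘ.≃ mkℚᵘ (+ n) 0
  cancel-≃ = *≡* (begin
    (+ suc k ℤ.* + n) ℤ.* + 1  ≡⟨ ℤ.*-identityʳ _ ⟩
    + suc k ℤ.* + n            ≡⟨ ℤ.*-comm (+ suc k) (+ n) ⟩
    + n ℤ.* + suc k            ≡⟨ cong (λ d → + n ℤ.* + d) (ℕ.*-identityˡ (suc k)) ⟨
    + n ℤ.* + (1 ℕ.* suc k)    ∎)

fromℕ-2qqab+7abb+2qam : ∀ q a b m →
  fromℕ (2 ℕ.* q ℕ.* q ℕ.* a ℕ.* b ℕ.+ 7 ℕ.* a ℕ.* b ℕ.* b ℕ.+ 2 ℕ.* q ℕ.* a ℕ.* m) ≡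
  fromℕ 2 * fromℕ q * fromℕ q * fromℕ a * fromℕ b + fromℕ 7 * fromℕ a * fromℕ b * fromℕ b
    + fromℕ 2 * fromℕ q * fromℕ a * fromℕ m
fromℕ-2qqab+7abb+2qam q a b m =
  trans (fromℕ-homo-+ (2 ℕ.* q ℕ.* q ℕ.* a ℕ.* b ℕ.+ 7 ℕ.* a ℕ.* b ℕ.* b) (2 ℕ.* q ℕ.* a ℕ.* m))
    (cong₂ _+_ (trans (fromℕ-homo-+ (2 ℕ.* q ℕ.* q ℕ.* a ℕ.* b) (7 ℕ.* a ℕ.* b ℕ.* b))
                      (cong₂ _+_ (fromℕ-foldl-* 2 (q ∷ q ∷ a ∷ b ∷ [])) (fromℕ-foldl-* 7 (a ∷ b ∷ b ∷ []))))
               (fromℕ-foldl-* 2 (q ∷ a ∷ m ∷ [])))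

fromℕ-18qqab+11abb : ∀ q a b →
  fromℕ (18 ℕ.* q ℕ.* q ℕ.* a ℕ.* b ℕ.+ 11 ℕ.* a ℕ.* b ℕ.* b) ≡
  fromℕ 18 * fromℕ q * fromℕ q * fromℕ a * fromℕ b + fromℕ 11 * fromℕ a * fromℕ b * fromℕ b
fromℕ-18qqab+11abb q a b =
  trans (fromℕ-homo-+ (18 ℕ.* q ℕ.* q ℕ.* a ℕ.* b) (11 ℕ.* a ℕ.* b ℕ.* b))
    (cong₂ _+_ (fromℕ-foldl-* 18 (q ∷ q ∷ a ∷ b ∷ [])) (fromℕ-foldl-* 11 (a ∷ b ∷ b ∷ [])))

0≤+n/d : ∀ n d .{{_ : ℕ.NonZero d}} → 0ℚ ≤ + n / d
0≤+n/d n d = nonNegative⁻¹ _ {{normalize-nonNeg n d}}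

0≤fromℕ : ∀ n → 0ℚ ≤ fromℕ n
0≤fromℕ n = 0≤+n/d n 1

#_ : ∀ {n} → ℕ → Polynomial n
# k = con (fromℕ k)

0≤* : ∀ {p r} → 0ℚ ≤ p → 0ℚ ≤ r → 0ℚ ≤ p * r
0≤* {p} {r} 0≤p 0≤r = nonNegative⁻¹ (p * r)
  {{nonNeg*nonNeg⇒nonNeg p {{nonNegative 0≤p}} r {{nonNegative 0≤r}}}}

p≤p+q : ∀ {p q} → 0ℚ ≤ q → p ≤ p + q
p≤p+q {p} {q} 0≤q = subst (_≤ p + q) (+-identityʳ p) (+-monoʳ-≤ p 0≤q)

*-self-mono-≤ : ∀ {x y} → 0ℚ ≤ x → x ≤ y → x * x ≤ y * y
*-self-mono-≤ {x} {y} 0≤x x≤y = ≤-trans (*-monoˡ-≤-nonNeg x {{nonNegative 0≤x}} x≤y)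
  (*-monoʳ-≤-nonNeg y {{nonNegative (≤-trans 0≤x x≤y)}} x≤y)

∣p∣*∣p∣≡p*p : ∀ p → ∣ p ∣ * ∣ p ∣ ≡ p * p
∣p∣*∣p∣≡p*p p with ∣p∣≡p∨∣p∣≡-p p
... | inj₁ ∣p∣≡p  = cong₂ _*_ ∣p∣≡p ∣p∣≡p
... | inj₂ ∣p∣≡-p = trans (cong₂ _*_ ∣p∣≡-p ∣p∣≡-p) (solve 1 (λ p → :- p :* :- p := p :* p) refl p)

infix 4 _≤√_

_≤√_ : ℚ → ℚ → Set
x ≤√ c = x ≤ 0ℚ ⊎ x * x ≤ c

≤√⇒LeSqrtPlusSqrt : ∀ {a a′ b b′ c c′ d d′} → a ≡ a′ → b ≡ b′ → c ≡ c′ → d ≡ d′ →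
  a′ * a′ - b′ ≤√ c′ * c′ * d′ → LeSqrtPlusSqrt a b c d
≤√⇒LeSqrtPlusSqrt refl refl refl refl a*a-b≤√c*c*d = a*a-b≤√c*c*d

≤-≤√-trans : ∀ {x y c} → y ≤ x → x ≤√ c → y ≤√ c
≤-≤√-trans y≤x (inj₁ x≤0)  = inj₁ (≤-trans y≤x x≤0)
≤-≤√-trans {y = y} y≤x (inj₂ x*x≤c) with y ≤? 0ℚ
... | yes y≤0 = inj₁ y≤0
... | no  y≰0 = inj₂ (≤-trans (*-self-mono-≤ (<⇒≤ (≰⇒> y≰0)) y≤x) x*x≤c)

≤√-monoʳ-≤ : ∀ {x c d} → c ≤ d → x ≤√ c → x ≤√ d
≤√-monoʳ-≤ c≤d (inj₁ x≤0)  = inj₁ x≤0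
≤√-monoʳ-≤ c≤d (inj₂ x*x≤c) = inj₂ (≤-trans x*x≤c c≤d)

*-≤√ : ∀ {s x c} → 0ℚ ≤ s → x ≤√ c → s * x ≤√ s * s * c
*-≤√ {s} 0≤s (inj₁ x≤0) =
  inj₁ (subst (s * _ ≤_) (*-zeroʳ s) (*-monoˡ-≤-nonNeg s {{nonNegative 0≤s}} x≤0))
*-≤√ {s} {x} 0≤s (inj₂ x*x≤c) =
  inj₂ (begin
    s * x * (s * x)  ≡⟨ solve 2 (λ s x → s :* x :* (s :* x) := s :* s :* (x :* x)) refl s x ⟩
    s * s * (x * x)  ≤⟨ *-monoˡ-≤-nonNeg (s * s) {{nonNegative (0≤* 0≤s 0≤s)}} x*x≤c ⟩
    s * s * _        ∎)
  where open ≤-Reasoning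

quadratic-≤√ : ∀ {a b r} → 0ℚ ≤ a →
  r * r ≤ fromℕ 2 * a * a + b + fromℕ 2 * a * r → r - fromℕ 8 * a ≤√ b
quadratic-≤√ {a} {b} {r} 0≤a r*r≤ with r - fromℕ 8 * a ≤? 0ℚ
... | yes u≤0 = inj₁ u≤0
... | no  u≰0 = inj₂ (begin
  u * u                                           ≤⟨ p≤p+q 0≤slack ⟩
  (r - fromℕ 8 * a) * (r - fromℕ 8 * a) + (fromℕ 14 * a * (r - fromℕ 8 * a) + fromℕ 46 * a * a)
                                                  ≡⟨ solve 2 (λ a r → (r :- # 8 :* a) :* (r :- # 8 :* a) :+ (# 14 :* a :* (r :- # 8 :* a) :+ # 46 :* a :* a)
                                                           := r :* r :- (# 2 :* a :* a :+ # 2 :* a :* r)) refl a r ⟩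
  r * r - (fromℕ 2 * a * a + fromℕ 2 * a * r)    ≤⟨ +-monoˡ-≤ _ r*r≤ ⟩
  fromℕ 2 * a * a + b + fromℕ 2 * a * r - (fromℕ 2 * a * a + fromℕ 2 * a * r)
                                                  ≡⟨ solve 3 (λ a b r → # 2 :* a :* a :+ b :+ # 2 :* a :* r :- (# 2 :* a :* a :+ # 2 :* a :* r) := b) refl a b r ⟩
  b                                               ∎)
  where
  open ≤-Reasoning
  u = r - fromℕ 8 * a
  0≤u : 0ℚ ≤ u
  0≤u = <⇒≤ (≰⇒> u≰0)
  0≤slack : 0ℚ ≤ fromℕ 14 * a * u + fromℕ 46 * a * a
  0≤slack = +-mono-≤ (0≤* (0≤* (0≤fromℕ 14) 0≤a) 0≤u) (0≤* (0≤* (0≤fromℕ 46) 0≤a) 0≤a)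

M-excess-≤√ : ∀ {p f m w g} → 0ℚ ≤ p → 0ℚ ≤ f → 0ℚ ≤ g → p * g ≡ f * f → m ≡ w →
  ∣ w - g ∣ * ∣ w - g ∣ ≤ fromℕ 2 * p * p * f * f + fromℕ 7 * f * f * f + fromℕ 2 * p * f * m →
  m - fromℕ 8 * p * f - fromℕ 2 * g ≤√ fromℕ 9 * f * f * f
M-excess-≤√ {p} {f} {.w} {w} {g} 0≤p 0≤f 0≤g p*g≡f*f refl bound =
  ≤-≤√-trans shift (quadratic-≤√ (0≤* 0≤p 0≤f) quadratic)
  where
  open ≤-Reasoning
  shift : w - fromℕ 8 * p * f - fromℕ 2 * g ≤ w - g - fromℕ 8 * (p * f)
  shift = begin
    w - fromℕ 8 * p * f - fromℕ 2 * g        ≤⟨ p≤p+q 0≤g ⟩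
    w - fromℕ 8 * p * f - fromℕ 2 * g + g
      ≡⟨ solve 4 (λ p f w g → w :- # 8 :* p :* f :- # 2 :* g :+ g := w :- g :- # 8 :* (p :* f)) refl p f w g ⟩
    w - g - fromℕ 8 * (p * f)                ∎
  quadratic : (w - g) * (w - g) ≤
    fromℕ 2 * (p * f) * (p * f) + fromℕ 9 * f * f * f + fromℕ 2 * (p * f) * (w - g)
  quadratic = begin
    (w - g) * (w - g)
      ≡⟨ ∣p∣*∣p∣≡p*p (w - g) ⟨
    ∣ w - g ∣ * ∣ w - g ∣
      ≤⟨ bound ⟩
    fromℕ 2 * p * p * f * f + fromℕ 7 * f * f * f + fromℕ 2 * p * f * w
      ≡⟨ solve 4 (λ p f w g → # 2 :* p :* p :* f :* f :+ # 7 :* f :* f :* f :+ # 2 :* p :* f :* w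
                 := # 2 :* (p :* f) :* (p :* f) :+ # 7 :* f :* f :* f :+ # 2 :* (p :* f) :* (w :- g) :+ # 2 :* f :* (p :* g))
                 refl p f w g ⟩
    fromℕ 2 * (p * f) * (p * f) + fromℕ 7 * f * f * f + fromℕ 2 * (p * f) * (w - g) + fromℕ 2 * f * (p * g)
      ≡⟨ cong (λ z → fromℕ 2 * (p * f) * (p * f) + fromℕ 7 * f * f * f + fromℕ 2 * (p * f) * (w - g) + fromℕ 2 * f * z) p*g≡f*f ⟩
    fromℕ 2 * (p * f) * (p * f) + fromℕ 7 * f * f * f + fromℕ 2 * (p * f) * (w - g) + fromℕ 2 * f * (f * f)
      ≡⟨ solve 4 (λ p f w g → # 2 :* (p :* f) :* (p :* f) :+ # 7 :* f :* f :* f :+ # 2 :* (p :* f) :* (w :- g) :+ # 2 :* f :* (f :* f)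
                 := # 2 :* (p :* f) :* (p :* f) :+ # 9 :* f :* f :* f :+ # 2 :* (p :* f) :* (w :- g))
                 refl p f w g ⟩
    fromℕ 2 * (p * f) * (p * f) + fromℕ 9 * f * f * f + fromℕ 2 * (p * f) * (w - g)
      ∎

N-excess-≤√ : ∀ {p e f m g x} → 0ℚ ≤ p → 0ℚ ≤ e → 0ℚ ≤ f → p * g ≡ f * f →
  x ≤ fromℕ 2 * p * p * e * f + fromℕ 7 * e * f * f + fromℕ 2 * p * e * m →
  m - fromℕ 8 * p * f - fromℕ 2 * g ≤√ fromℕ 9 * f * f * f →
  x - (fromℕ 18 * p * p * e * f + fromℕ 11 * e * f * f) ≤√
    fromℕ 4 * p * e * f * (fromℕ 4 * p * e * f) * (fromℕ 7 * f)
N-excess-≤√ {p} {e} {f} {m} {g} {x} 0≤p 0≤e 0≤f p*g≡f*f bound excess =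
  ≤√-monoʳ-≤ weaken (≤-≤√-trans shift (*-≤√ 0≤2pe excess))
  where
  open ≤-Reasoning
  0≤2pe : 0ℚ ≤ fromℕ 2 * p * e
  0≤2pe = 0≤* (0≤* (0≤fromℕ 2) 0≤p) 0≤e
  0≤pef : 0ℚ ≤ p * e * f
  0≤pef = 0≤* (0≤* 0≤p 0≤e) 0≤f
  shift : x - (fromℕ 18 * p * p * e * f + fromℕ 11 * e * f * f) ≤
          fromℕ 2 * p * e * (m - fromℕ 8 * p * f - fromℕ 2 * g)
  shift = begin
    x - (fromℕ 18 * p * p * e * f + fromℕ 11 * e * f * f)
      ≤⟨ +-monoˡ-≤ _ bound ⟩
    fromℕ 2 * p * p * e * f + fromℕ 7 * e * f * f + fromℕ 2 * p * e * m
      - (fromℕ 18 * p * p * e * f + fromℕ 11 * e * f * f)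
      ≡⟨ solve 5 (λ p e f m g → # 2 :* p :* p :* e :* f :+ # 7 :* e :* f :* f :+ # 2 :* p :* e :* m
                                  :- (# 18 :* p :* p :* e :* f :+ # 11 :* e :* f :* f)
                 := # 2 :* p :* e :* (m :- # 8 :* p :* f :- # 2 :* g) :+ # 4 :* e :* (p :* g) :- # 4 :* e :* (f :* f))
                 refl p e f m g ⟩
    fromℕ 2 * p * e * (m - fromℕ 8 * p * f - fromℕ 2 * g) + fromℕ 4 * e * (p * g) - fromℕ 4 * e * (f * f)
      ≡⟨ cong (λ z → fromℕ 2 * p * e * (m - fromℕ 8 * p * f - fromℕ 2 * g) + fromℕ 4 * e * z - fromℕ 4 * e * (f * f)) p*g≡f*f ⟩
    fromℕ 2 * p * e * (m - fromℕ 8 * p * f - fromℕ 2 * g) + fromℕ 4 * e * (f * f) - fromℕ 4 * e * (f * f)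
      ≡⟨ solve 5 (λ p e f m g → # 2 :* p :* e :* (m :- # 8 :* p :* f :- # 2 :* g) :+ # 4 :* e :* (f :* f) :- # 4 :* e :* (f :* f)
                 := # 2 :* p :* e :* (m :- # 8 :* p :* f :- # 2 :* g))
                 refl p e f m g ⟩
    fromℕ 2 * p * e * (m - fromℕ 8 * p * f - fromℕ 2 * g)
      ∎
  weaken : fromℕ 2 * p * e * (fromℕ 2 * p * e) * (fromℕ 9 * f * f * f) ≤
           fromℕ 4 * p * e * f * (fromℕ 4 * p * e * f) * (fromℕ 7 * f)
  weaken = begin
    fromℕ 2 * p * e * (fromℕ 2 * p * e) * (fromℕ 9 * f * f * f)
      ≤⟨ p≤p+q (0≤* (0≤* (0≤* (0≤fromℕ 76) 0≤pef) 0≤pef) 0≤f) ⟩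
    fromℕ 2 * p * e * (fromℕ 2 * p * e) * (fromℕ 9 * f * f * f) + fromℕ 76 * (p * e * f) * (p * e * f) * f
      ≡⟨ solve 3 (λ p e f → # 2 :* p :* e :* (# 2 :* p :* e) :* (# 9 :* f :* f :* f) :+ # 76 :* (p :* e :* f) :* (p :* e :* f) :* f
                 := # 4 :* p :* e :* f :* (# 4 :* p :* e :* f) :* (# 7 :* f))
                 refl p e f ⟩
    fromℕ 4 * p * e * f * (fromℕ 4 * p * e * f) * (fromℕ 7 * f)
      ∎

foldr-⊔-attained : ∀ {A : Set} (g : A → ℕ) x xs → ∃[ y ] foldr _⊔_ 0 (map g (x ∷ xs)) ≡ g y
foldr-⊔-attained g x []        = x , ℕ.⊔-identityʳ (g x)
foldr-⊔-attained g x (x′ ∷ xs) with foldr-⊔-attained g x′ xs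
... | y , rest≡gy with ℕ.⊔-sel (g x) (foldr _⊔_ 0 (map g (x′ ∷ xs)))
...   | inj₁ max≡gx   = x , max≡gx
...   | inj₂ max≡rest = y , trans max≡rest rest≡gy

module _ (𝔽 : FiniteField) where
  open FiniteField 𝔽

  commutativeRing : CommutativeRing 0ℓ 0ℓ
  commutativeRing = record { isCommutativeRing = isCommutativeRing }

  -- No zero test: the normaliser then never has to decide 0# ≟ c for constants c of
  -- the abstract field, so that both normal forms are compared by refl.
  private
    module Poly = Tactic.RingSolver.NonReflective (fromCommutativeRing commutativeRing (λ _ → nothing))

  det-+ : ∀ x y → det (x +M y) ≡ (x ⊙ y) ⊕ (det x ⊕ det y)
  det-+ (mat a b c d) (mat e f g h) = Poly.solve 8 (λ a b c d e f g h →
      ((a Poly.⊕ e) Poly.⊗ (d Poly.⊕ h)) Poly.⊕ (Poly.⊝ ((b Poly.⊕ f) Poly.⊗ (c Poly.⊕ g)))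
    Poly.⊜ (((((a Poly.⊗ h) Poly.⊕ (Poly.⊝ (b Poly.⊗ g))) Poly.⊕ (Poly.⊝ (c Poly.⊗ f))) Poly.⊕ (d Poly.⊗ e))
            Poly.⊕ (((a Poly.⊗ d) Poly.⊕ (Poly.⊝ (b Poly.⊗ c))) Poly.⊕ ((e Poly.⊗ h) Poly.⊕ (Poly.⊝ (f Poly.⊗ g))))))
    refl a b c d e f g h

  x⊕u≡t⇔x≡t⊖u : ∀ x u t → (x ⊕ u ≡ t) ⇔ (x ≡ t ⊖ u)
  x⊕u≡t⇔x≡t⊖u x u t = mk⇔ (x≈z//y x u t) (λ x≡t⊖u → trans (cong (_⊕ u) x≡t⊖u) (//-rightDividesˡ u t))
    where open GroupProperties (CommutativeRing.+-group commutativeRing)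

  countPairs-cong : ∀ {E F} {P P′ : Mat → Mat → Bool} →
    (∀ {x y} → E x ≡ true → F y ≡ true → P x y ≡ P′ x y) → countPairs E F P ≡ countPairs E F P′
  countPairs-cong {E} {F} {P} {P′} P≡P′ =
    cong (sum ∘ concat) (map-cong (λ x → map-cong (entry x) allMats) allMats)
    where
    entry : ∀ x y → (if E x then (if F y then ind (P x y) else 0) else 0)
                  ≡ (if E x then (if F y then ind (P′ x y) else 0) else 0)
    entry x y with E x in Ex | F y in Fy
    ... | true  | true  = cong ind (P≡P′ Ex Fy)
    ... | true  | false = refl
    ... | false | _     = refl

  N≡W : ∀ {i j E F} → E ⊆D i → F ⊆D j → ∀ t → N t E F ≡ W (t ⊖ (i ⊕ j)) E F
  N≡W {i} {j} {E} {F} E⊆Di F⊆Dj t = countPairs-cong λ {x} {y} Ex Fy →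
    does-⇔ (det-+≡t⇔ x y Ex Fy) (det (x +M y) ≟ t) ((x ⊙ y) ≟ (t ⊖ (i ⊕ j)))
    where
    det-+≡t⇔ : ∀ x y → E x ≡ true → F y ≡ true → (det (x +M y) ≡ t) ⇔ (x ⊙ y ≡ t ⊖ (i ⊕ j))
    det-+≡t⇔ x y Ex Fy rewrite det-+ x y | E⊆Di x Ex | F⊆Dj y Fy = x⊕u≡t⇔x≡t⊖u (x ⊙ y) (i ⊕ j) t

  M-attained : ∀ E F → ∃[ ℓ ] M E F ≡ W ℓ E F
  M-attained E F = nonEmpty elems (complete 0#)
    where
    nonEmpty : ∀ xs → 0# ∈ xs → ∃[ ℓ ] foldr _⊔_ 0 (map (λ ℓ → W ℓ E F) xs) ≡ W ℓ E F
    nonEmpty (x ∷ xs) _ = foldr-⊔-attained (λ ℓ → W ℓ E F) x xs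

  q≡suc : ∃[ k ] q ≡ suc k
  q≡suc with elems | complete 0#
  ... | _ ∷ xs | _ = length xs , refl

  /q-≡ : ∀ {k} n → q ≡ suc k → n /q ≡ + n / suc k
  /q-≡ n eq with q
  /q-≡ n refl | .(suc _) = refl

  q*[n/q]≡n : ∀ n → ℕ→ℚ q * (n /q) ≡ ℕ→ℚ n
  q*[n/q]≡n n with k , q≡1+k ← q≡suc rewrite /q-≡ n q≡1+k | q≡1+k = fromℕ-*-/ n k

  0≤n/q : ∀ n → 0ℚ ≤ n /q
  0≤n/q n with k , q≡1+k ← q≡suc rewrite /q-≡ n q≡1+k = 0≤+n/d n (suc k)

lemma3p2 : (𝔽 : FiniteField) → let open FiniteField 𝔽 in
  q % 2 ≡ 1 →
  (i j : Carrier) → ¬ (i ≡ 0#) → ¬ (j ≡ 0#) →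
  (E F : Subset) → E ⊆D i → F ⊆D j →
  (∀ ℓ → sq ∣ R ℓ E F ∣ ≤ ℕ→ℚ (2 Data.Nat.* q Data.Nat.* q Data.Nat.* card E Data.Nat.* card F Data.Nat.+ 7 Data.Nat.* card E Data.Nat.* card F Data.Nat.* card F Data.Nat.+ 2 Data.Nat.* q Data.Nat.* card E Data.Nat.* M F F)) →
  (∀ ℓ → sq ∣ R ℓ F F ∣ ≤ ℕ→ℚ (2 Data.Nat.* q Data.Nat.* q Data.Nat.* card F Data.Nat.* card F Data.Nat.+ 7 Data.Nat.* card F Data.Nat.* card F Data.Nat.* card F Data.Nat.+ 2 Data.Nat.* q Data.Nat.* card F Data.Nat.* M F F)) →
  ∀ t → LeSqrtPlusSqrt ∣ ℕ→ℚ (N t E F) - ((card E Data.Nat.* card F) /q) ∣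
          (ℕ→ℚ (18 Data.Nat.* q Data.Nat.* q Data.Nat.* card E Data.Nat.* card F Data.Nat.+ 11 Data.Nat.* card E Data.Nat.* card F Data.Nat.* card F))
          (ℕ→ℚ (4 Data.Nat.* q Data.Nat.* card E Data.Nat.* card F))
          (ℕ→ℚ (7 Data.Nat.* card F))
lemma3p2 𝔽 _ i j _ _ E F E⊆Di F⊆Dj boundEF boundFF t =
  ≤√⇒LeSqrtPlusSqrt (cong (λ n → ∣ ℕ→ℚ n - (card E ℕ.* card F) /q ∣) (N≡W 𝔽 E⊆Di F⊆Dj t))
    (fromℕ-18qqab+11abb q (card E) (card F))
    (fromℕ-foldl-* 4 (q ∷ card E ∷ card F ∷ []))
    (fromℕ-foldl-* 7 (card F ∷ [])) $
  N-excess-≤√ (0≤fromℕ q) (0≤fromℕ (card E)) (0≤fromℕ (card F)) q*g≡f*f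
    (≤-trans (boundEF (t ⊖ (i ⊕ j))) (≤-reflexive (fromℕ-2qqab+7abb+2qam q (card E) (card F) (M F F))))
    (M-excess-≤√ (0≤fromℕ q) (0≤fromℕ (card F)) (0≤n/q 𝔽 (card F ℕ.* card F)) q*g≡f*f
      (cong ℕ→ℚ (proj₂ attained))
      (≤-trans (boundFF (proj₁ attained)) (≤-reflexive (fromℕ-2qqab+7abb+2qam q (card F) (card F) (M F F)))))
  where
  open FiniteField 𝔽
  attained : ∃[ ℓ ] M F F ≡ W ℓ F F
  attained = M-attained 𝔽 F F
  q*g≡f*f : ℕ→ℚ q * ((card F ℕ.* card F) /q) ≡ ℕ→ℚ (card F) * ℕ→ℚ (card F)
  q*g≡f*f = trans (q*[n/q]≡n 𝔽 (card F ℕ.* card F)) (fromℕ-homo-* (card F) (card F))
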